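{- Let $\underline{v}$ be a UD-word in the simple transpositions of $\mathfrak{S}_n$. If $u\in\mathfrak{S}_n$ satisfies $\mathbb{L}_{\underline{v}}(u)\neq\emptyset$, then $$\tilde{\mathcal{R}}_{u,\underline{v}}(t)=t^{c}(t^2+1)^{\frac{1}{2}(\ell(\underline{v})-\ell(u)-c)}$$ for some $c\in\mathbb{N}$, where $\ell(\underline{v})$ is the number of letters of $\underline{v}$ and $\ell(u)$ the Coxeter length of $u$.
   Context: $\mathfrak{S}_n$ has Coxeter generators $s_i=(i,i+1)$, $1\le i<n$. A word $\underline{v}$ is a UD-word if $\underline{v}=(s_{i_1}\cdots s_{i_r})\,s_t\,(s_{j_1}\cdots s_{j_q})$ with $1\le i_1<\cdots<i_r<t<n$ and $1\le j_q<\cdots<j_1<t<n$ (parenthesized parts may be empty; the word need not be reduced). Light leaves and diagrammatic polynomials: An $S$-graph is a finite planar graph with boundary in $\mathbb{R}\times[0,1]$, edges coloured by $S$, vertices either univalent ("dots") or $2m_{st}$-valent ($m_{st}$ the order of $st$) with edges alternately coloured $s,t$; the top sequence is the word read on the top boundary; the degree is the number of dots. For a word $\underline{v}=s_1\cdots s_m$, the tree $\mathbb{T}_{\underline{v}}$ has root decorated by the empty diagram; a node of depth $k-1$ decorated by $D$ with top sequence a reduced expression $\underline{u}$ of $u$ has: if $\ell(us_k)>\ell(u)$, two children ($D$ plus an $s_k$-coloured straight strand on the right, top $\underline{u}s_k$; $D$ plus an $s_k$ strand ending in a dot on the right, top $\underline{u}$, degree $+1$); if $\ell(us_k)<\ell(u)$,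 one child obtained by stacking $2m_{st}$-valent vertices on $D$ realizing braid moves from $\underline{u}$ to a reduced expression $\underline{u}''s_k$, then joining the rightmost top $s_k$ strand to a new $s_k$ strand from the bottom by an arc (top $\underline{u}''$, degree unchanged). The leaves are light leaves; $\mathbb{L}_{\underline{v}}(u)$ is the set of those with top sequence a reduced expression of $u$ (for any admissible choice of braid moves), and $\tilde{\mathcal{R}}_{u,\underline{v}}(t)=\sum_{l\in\mathbb{L}_{\underline{v}}(u)}t^{\deg(l)}$. -}

module Defs where

open import Data.Nat using (ℕ; zero; suc; _+_; _*_; _∸_; _<ᵇ_; _≡ᵇ_)
open import Data.Bool using (Bool; true; false; if_then_else_; _∧_)
open import Data.Fin using (Fin; inject₁; toℕ) renaming (suc to fsuc; _<_ to _<ꟳ_; _>_ to _>ꟳ_)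
open import Data.Fin.Properties using (all?; _≟_)
open import Data.Fin.Permutation using (Permutation′; _⟨$⟩ʳ_)
open import Data.Fin.Permutation.Components using (transpose)
open import Data.List using (List; []; _∷_; [_]; _++_; foldl; concatMap; filter; map; upTo; allFin; length)
open import Data.Nat.ListAction using (sum)
open import Data.List.Relation.Unary.All using (All)
open import Data.List.Relation.Unary.Linked using (Linked)
open import Data.Product using (_×_; _,_; ∃-syntax; proj₁; proj₂)
open import Function using (_∘_; id)
open import Relation.Binary.PropositionalEquality using (_≡_)

-- The symmetric group S_n with n = suc m, realised as maps Fin n → Fin n
-- (one-line notation).  Coxeter generators s_i, i = 0 … m-1 (0-based:
-- s_i swaps i and i+1, i.e. the paper's s_{i+1}).

Elt : ℕ → Set
Elt m = Fin (suc m) → Fin (suc m)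

gen : ∀ {m} → Fin m → Fin (suc m) → Fin (suc m)
gen i = transpose (inject₁ i) (fsuc i)

_·s_ : ∀ {m} → Elt m → Fin m → Elt m
u ·s i = u ∘ gen i

-- Coxeter length in S_n = number of inversions
ℓ : ∀ {m} → Elt m → ℕ
ℓ {m} u = sum (map (λ i → sum (map (λ j →
            if (toℕ i <ᵇ toℕ j) ∧ (toℕ (u j) <ᵇ toℕ (u i)) then 1 else 0)
          (allFin (suc m)))) (allFin (suc m)))

UDWord : ∀ {m} → List (Fin m) → Set
UDWord {m} v = ∃[ pre ] ∃[ t ] ∃[ suf ]
  ( v ≡ pre ++ [ t ] ++ suf
  × Linked _<ꟳ_ pre × All (_<ꟳ t) pre
  × Linked _>ꟳ_ suf × All (_<ꟳ t) suf )

-- The light-leaves tree T_v.  A node is recorded by the element u whose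
-- reduced expression is its top sequence, together with its degree
-- (number of dots).  Children of a node at letter s:
--   ℓ(us) > ℓ(u):  (us, d)  and  (u, d+1)   (straight strand / dot)
--   ℓ(us) < ℓ(u):  (us, d)                  (braid moves + arc)

Node : ℕ → Set
Node m = Elt m × ℕ

children : ∀ {m} → Fin m → Node m → List (Node m)
children s (u , d) =
  if ℓ u <ᵇ ℓ (u ·s s)
  then (u ·s s , d) ∷ (u , suc d) ∷ []
  else (u ·s s , d) ∷ []

leaves : ∀ {m} → List (Fin m) → List (Node m)
leaves {m} v = foldl (λ nodes s → concatMap (children s) nodes) ((id , 0) ∷ []) v

-- 𝕃_v(u): the leaves whose top sequence is a reduced expression of u
𝕃 : ∀ {m} → List (Fin m) → Permutation′ (suc m) → List (Node m)
𝕃 v u = filter (λ nd → all? (λ x → proj₁ nd x ≟ (u ⟨$⟩ʳ x))) (leaves v)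

Poly : Set
Poly = ℕ → ℕ

0ₚ : Poly
0ₚ _ = 0

t^ : ℕ → Poly
t^ e d = if e ≡ᵇ d then 1 else 0

_⊕_ : Poly → Poly → Poly
(p ⊕ q) d = p d + q d

_⊛_ : Poly → Poly → Poly
(p ⊛ q) d = sum (map (λ i → p i * q (d ∸ i)) (upTo (suc d)))

_^ₚ_ : Poly → ℕ → Poly
p ^ₚ zero = t^ 0
p ^ₚ suc k = p ⊛ (p ^ₚ k)

R̃ : ∀ {m} → Permutation′ (suc m) → List (Fin m) → Poly
R̃ u v = Data.List.foldr (λ nd acc → t^ (proj₂ nd) ⊕ acc) 0ₚ (𝕃 v u)
  where import Data.List

-- Every UD-word arises from the empty word by repeatedly adding a letter s_a smaller than all
-- letters already present: on the left, on the right, or on both ends.  Write count g w for the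
-- polynomial R̃_{g,w}.  The leaves of a word in letters above a are permutations that fix the
-- position a and keep the positions above a above it.  Hence adding s_a on the left gives
-- count g (s_a w) = count (s_a g) w + t·count g w, and on the right
-- count g (w s_a) = count (g s_a) w + [g(a) < g(a+1)]·t·count g w, where at most one term survives;
-- adding it on both ends leaves, depending on where g sends a and a+1, one of count h w,
-- t·count h w, t²·count g w or (1 + t²)·count g w, with h one of s_a g, g s_a, s_a g s_a, of length
-- ℓ(g) - 1 or ℓ(g) - 2.  By induction count g w is 0 or t^c (1 + t²)^k with 2k + c + ℓ(g) = ℓ(w).
module Submission where

open import Defs
open import Data.Bool using (Bool; true; false; if_then_else_; _∧_)
open import Data.Bool.Properties using (∧-zeroʳ)
open import Data.Empty using (⊥-elim)
open import Data.Fin using (Fin; inject₁; toℕ; punchIn) renaming (zero to fzero; suc to fsuc; _<_ to _<ꟳ_; _>_ to _>ꟳ_)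
open import Data.Fin.Properties using (_≟_; all?; toℕ-inject₁; toℕ-injective; punchInᵢ≢i)
  renaming (<-cmp to <-cmpꟳ; <-trans to <-transꟳ)
import Data.Fin.Permutation as Perm
open import Data.Fin.Permutation using (Permutation′; _⟨$⟩ʳ_)
open import Data.List
  using (List; []; _∷_; [_]; _∷ʳ_; _++_; concatMap; length; foldr; foldl; filter; map; allFin; tabulate; applyUpTo)
open import Data.List.Properties
  using (map-tabulate; foldl-∷ʳ; map-applyUpTo; map-++; concatMap-++; length-++; ++-assoc)
open import Data.List.Relation.Unary.All as All using (All; []; _∷_; universal-U)
open import Data.List.Relation.Unary.All.Properties using (∷ʳ⁺; concat⁺; map⁺; ++⁺; ++⁻; ++⁻ʳ)
open import Data.List.Relation.Unary.AllPairs using (AllPairs; []; _∷_)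
open import Data.List.Relation.Unary.Linked.Properties using (Linked⇒AllPairs)
open import Data.List.Reverse using (Reverse; []; _∶_∶ʳ_; reverseView)
open import Data.Nat using (ℕ; zero; suc; _+_; _*_; _∸_; _<ᵇ_; _≡ᵇ_; _<_; _≤_; z≤n)
open import Data.Nat.ListAction using (sum)
open import Data.Nat.Properties as ℕ
  using ( _<?_; <-irrefl; <-asym; <-trans; ≤-trans; ≤-refl; n<1+n; n≤1+n; 1+n≢n; ≤∧≢⇒<; ≤-pred
        ; +-suc; +-comm; +-assoc; +-identityʳ )
open import Algebra.Properties.CommutativeSemigroup ℕ.+-commutativeSemigroup
  using (x∙yz≈y∙xz) renaming (interchange to +-interchange)
open import Algebra.Properties.CommutativeMonoid.Sum ℕ.+-0-commutativeMonoid
  using (sum-syntax; sum-cong-≗; ∑-distrib-+; sum-permute; sum-remove; sum-replicate-zero)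
  renaming (sum to ∑)
open import Data.Product using (_×_; _,_; ∃-syntax; proj₁; proj₂)
open import Data.Sum using (_⊎_; inj₁; inj₂)
open import Function using (_∘_; id)
open import Function.Bundles using (mk⇔)
open import Function.Definitions using (Injective)
open import Relation.Binary.Definitions using (Tri; tri<; tri≈; tri>)
open import Relation.Binary.PropositionalEquality hiding ([_])
import Relation.Binary.Reasoning.Setoid as SetoidReasoning
open import Relation.Nullary using (Dec; yes; no; does; ¬_)
open import Relation.Nullary.Decidable using (dec-true; dec-false; does-⇔; _×-dec_)
open import Relation.Unary using (U)

-- Adjacent transpositions and the Coxeter length

adjSwap : ℕ → ℕ → ℕ
adjSwap c x = if x ≡ᵇ c then suc c else if x ≡ᵇ suc c then c else x

adjSwap-at : ∀ c → adjSwap c c ≡ suc c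
adjSwap-at c rewrite dec-true (c ℕ.≟ c) refl = refl

adjSwap-at-suc : ∀ c → adjSwap c (suc c) ≡ c
adjSwap-at-suc c rewrite dec-false (suc c ℕ.≟ c) 1+n≢n | dec-true (c ℕ.≟ c) refl = refl

adjSwap-fixes : ∀ c x → x ≢ c → x ≢ suc c → adjSwap c x ≡ x
adjSwap-fixes c x x≢c x≢1+c rewrite dec-false (x ℕ.≟ c) x≢c | dec-false (x ℕ.≟ suc c) x≢1+c = refl

adjSwap-involutive : ∀ c x → adjSwap c (adjSwap c x) ≡ x
adjSwap-involutive c x with x ℕ.≟ c
... | yes refl rewrite adjSwap-at c = adjSwap-at-suc c
... | no x≢c with x ℕ.≟ suc c
...   | yes refl rewrite adjSwap-at-suc c = adjSwap-at c
...   | no x≢1+c rewrite adjSwap-fixes c x x≢c x≢1+c = adjSwap-fixes c x x≢c x≢1+c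

adjSwap-mono-< : ∀ c x y → x < y → ¬ (x ≡ c × y ≡ suc c) → adjSwap c x < adjSwap c y
adjSwap-mono-< c x y x<y not-swapped with x ℕ.≟ c | x ℕ.≟ suc c
... | yes refl | _
  rewrite adjSwap-at c | adjSwap-fixes c y (λ e → <-irrefl (sym e) x<y) (λ e → not-swapped (refl , e))
  = ≤∧≢⇒< x<y (λ e → not-swapped (refl , sym e))
... | no _ | yes refl
  rewrite adjSwap-at-suc c
        | adjSwap-fixes c y (λ e → <-asym x<y (subst (_< suc c) (sym e) (n<1+n c))) (λ e → <-irrefl (sym e) x<y)
  = <-trans (n<1+n c) x<y
... | no x≢c | no x≢1+c rewrite adjSwap-fixes c x x≢c x≢1+c with y ℕ.≟ c | y ℕ.≟ suc c
...   | yes refl | _ rewrite adjSwap-at c = <-trans x<y (n<1+n c)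
...   | no _ | yes refl rewrite adjSwap-at-suc c = ≤∧≢⇒< (≤-pred x<y) x≢c
...   | no y≢c | no y≢1+c rewrite adjSwap-fixes c y y≢c y≢1+c = x<y

adjSwap-preserves-<ᵇ : ∀ c x y → ¬ (x ≡ c × y ≡ suc c) → ¬ (x ≡ suc c × y ≡ c) →
  (adjSwap c x <ᵇ adjSwap c y) ≡ (x <ᵇ y)
adjSwap-preserves-<ᵇ c x y ¬xy ¬yx with x <? y
... | yes x<y = trans (dec-true (_ <? _) (adjSwap-mono-< c x y x<y ¬xy)) (sym (dec-true (x <? y) x<y))
... | no x≮y = trans (dec-false (_ <? _) x′≮y′) (sym (dec-false (x <? y) x≮y))
  where
  unswap : ∀ {z w} → adjSwap c z ≡ w → z ≡ adjSwap c w
  unswap {z} e = trans (sym (adjSwap-involutive c z)) (cong (adjSwap c) e)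

  x′≮y′ : ¬ adjSwap c x < adjSwap c y
  x′≮y′ x′<y′ = x≮y (subst₂ _<_ (adjSwap-involutive c x) (adjSwap-involutive c y)
    (adjSwap-mono-< c _ _ x′<y′ λ (x′≡c , y′≡1+c) →
      ¬yx (trans (unswap x′≡c) (adjSwap-at c) , trans (unswap y′≡1+c) (adjSwap-at-suc c))))

adjSwap-preserves-≥ : ∀ {b c x} → b ≤ c → b ≤ x → b ≤ adjSwap c x
adjSwap-preserves-≥ {b} {c} {x} b≤c b≤x with x ℕ.≟ c
... | yes refl rewrite adjSwap-at c = ≤-trans b≤c (n≤1+n c)
... | no x≢c with x ℕ.≟ suc c
...   | yes refl rewrite adjSwap-at-suc c = b≤c
...   | no x≢1+c rewrite adjSwap-fixes c x x≢c x≢1+c = b≤x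

toℕ-gen : ∀ {m} (a : Fin m) k → toℕ (gen a k) ≡ adjSwap (toℕ a) (toℕ k)
toℕ-gen a k with k ≟ inject₁ a
... | yes refl rewrite toℕ-inject₁ a = sym (adjSwap-at (toℕ a))
... | no k≢a with k ≟ fsuc a
...   | yes refl = trans (toℕ-inject₁ a) (sym (adjSwap-at-suc (toℕ a)))
...   | no k≢1+a = sym (adjSwap-fixes (toℕ a) (toℕ k)
          (λ e → k≢a (toℕ-injective (trans e (sym (toℕ-inject₁ a))))) (λ e → k≢1+a (toℕ-injective e)))

gen-involutive : ∀ {m} (a : Fin m) k → gen a (gen a k) ≡ k
gen-involutive a k = toℕ-injective (begin
  toℕ (gen a (gen a k))                     ≡⟨ toℕ-gen a (gen a k) ⟩
  adjSwap (toℕ a) (toℕ (gen a k))           ≡⟨ cong (adjSwap (toℕ a)) (toℕ-gen a k) ⟩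
  adjSwap (toℕ a) (adjSwap (toℕ a) (toℕ k)) ≡⟨ adjSwap-involutive (toℕ a) (toℕ k) ⟩
  toℕ k                                     ∎)
  where open ≡-Reasoning

gen-inject₁ : ∀ {m} (a : Fin m) → gen a (inject₁ a) ≡ fsuc a
gen-inject₁ a = toℕ-injective (trans (toℕ-gen a (inject₁ a))
  (trans (cong (adjSwap (toℕ a)) (toℕ-inject₁ a)) (adjSwap-at (toℕ a))))

gen-fsuc : ∀ {m} (a : Fin m) → gen a (fsuc a) ≡ inject₁ a
gen-fsuc a = toℕ-injective (trans (toℕ-gen a (fsuc a)) (trans (adjSwap-at-suc (toℕ a)) (sym (toℕ-inject₁ a))))

gen-fixes : ∀ {m} (a : Fin m) k → toℕ k ≢ toℕ a → toℕ k ≢ suc (toℕ a) → gen a k ≡ k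
gen-fixes a k k≢a k≢1+a = toℕ-injective (trans (toℕ-gen a k) (adjSwap-fixes (toℕ a) (toℕ k) k≢a k≢1+a))

fsuc≢inject₁ : ∀ {m} (a : Fin m) → fsuc a ≢ inject₁ a
fsuc≢inject₁ a e = 1+n≢n (trans (cong toℕ e) (toℕ-inject₁ a))

sum-tabulate : ∀ {n} (f : Fin n → ℕ) → sum (tabulate f) ≡ ∑ f
sum-tabulate {zero} f = refl
sum-tabulate {suc n} f = cong (f fzero +_) (sum-tabulate (f ∘ fsuc))

sum-map-allFin : ∀ {n} (f : Fin n → ℕ) → sum (map f (allFin n)) ≡ ∑ f
sum-map-allFin f = trans (cong sum (map-tabulate id f)) (sum-tabulate f)

∑-δ : ∀ {n} (Q : Fin (suc n)) x → ∑[ j < suc n ] (if does (j ≟ Q) then x else 0) ≡ x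
∑-δ {n} Q x = begin
  ∑ δ                        ≡⟨ sum-remove {i = Q} δ ⟩
  δ Q + ∑ (δ ∘ punchIn Q)     ≡⟨ cong₂ _+_ (cong if-x (dec-true (Q ≟ Q) refl))
                                          (sum-cong-≗ (λ j → cong if-x (dec-false (_ ≟ Q) (punchInᵢ≢i Q j)))) ⟩
  x + ∑ (λ (_ : Fin n) → 0)   ≡⟨ cong (x +_) (sum-replicate-zero n) ⟩
  x + 0                       ≡⟨ +-identityʳ x ⟩
  x                           ∎
  where
  open ≡-Reasoning
  if-x : Bool → ℕ
  if-x b = if b then x else 0
  δ : Fin (suc n) → ℕ
  δ j = if-x (does (j ≟ Q))

∑∑ : ∀ {n} → (Fin n → Fin n → ℕ) → ℕ
∑∑ f = ∑ (λ i → ∑ (f i))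

∑∑-cong : ∀ {n} {f g : Fin n → Fin n → ℕ} → (∀ i j → f i j ≡ g i j) → ∑∑ f ≡ ∑∑ g
∑∑-cong {n} f≗g = sum-cong-≗ {n} (λ i → sum-cong-≗ {n} (f≗g i))

∑∑-distrib-+ : ∀ {n} (f g : Fin n → Fin n → ℕ) → ∑∑ (λ i j → f i j + g i j) ≡ ∑∑ f + ∑∑ g
∑∑-distrib-+ {n} f g =
  trans (sum-cong-≗ {n} (λ i → ∑-distrib-+ (f i) (g i))) (∑-distrib-+ (λ i → ∑ (f i)) (λ i → ∑ (g i)))

∑∑-zero : ∀ n → ∑∑ {n} (λ _ _ → 0) ≡ 0
∑∑-zero n = begin
  ∑ (λ (i : Fin n) → ∑ (λ (j : Fin n) → 0)) ≡⟨ sum-cong-≗ {n} (λ _ → sum-replicate-zero n) ⟩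
  ∑ (λ (i : Fin n) → 0)                      ≡⟨ sum-replicate-zero n ⟩
  0                                          ∎
  where open ≡-Reasoning

δ² : ∀ {n} → Fin n → Fin n → ℕ → Fin n → Fin n → ℕ
δ² P Q x i j = if does (i ≟ P) then (if does (j ≟ Q) then x else 0) else 0

∑∑-δ² : ∀ {n} (P Q : Fin (suc n)) x → ∑∑ (δ² P Q x) ≡ x
∑∑-δ² {n} P Q x = trans (sum-cong-≗ inner) (∑-δ P x)
  where
  inner : ∀ i → ∑[ j < suc n ] δ² P Q x i j ≡ (if does (i ≟ P) then x else 0)
  inner i with does (i ≟ P)
  ... | true  = ∑-δ Q x
  ... | false = sum-replicate-zero (suc n)

δ²-off : ∀ {n} (P Q : Fin n) x i j → ¬ (i ≡ P × j ≡ Q) → δ² P Q x i j ≡ 0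
δ²-off P Q x i j ¬PQ with i ≟ P | j ≟ Q
... | yes i≡P | yes j≡Q = ⊥-elim (¬PQ (i≡P , j≡Q))
... | yes _   | no _    = refl
... | no _    | _       = refl

𝟙 : Bool → ℕ
𝟙 b = if b then 1 else 0

inversion : ∀ {m} → Elt m → Fin (suc m) → Fin (suc m) → ℕ
inversion u i j = 𝟙 ((toℕ i <ᵇ toℕ j) ∧ (toℕ (u j) <ᵇ toℕ (u i)))

ℓ-as-∑ : ∀ {m} (u : Elt m) → ℓ u ≡ ∑∑ (inversion u)
ℓ-as-∑ {m} u = trans (sum-map-allFin (λ i → sum (map (inversion u i) (allFin (suc m)))))
  (sum-cong-≗ (λ i → sum-map-allFin (inversion u i)))

Ascent : ∀ {m} → Elt m → Fin m → Set
Ascent u a = toℕ (u (inject₁ a)) < toℕ (u (fsuc a))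

ascentᵇ : ∀ {m} → Elt m → Fin m → Bool
ascentᵇ u a = toℕ (u (inject₁ a)) <ᵇ toℕ (u (fsuc a))

-- Reindexing both sums by s_a, the inversions of u s_a and of u differ only at the pair (a, a+1).
module Exchange {m : ℕ} (u : Elt m) (a : Fin m) where
  A B : Fin (suc m)
  A = inject₁ a
  B = fsuc a

  α β : ℕ
  α = 𝟙 (ascentᵇ u a)
  β = 𝟙 (toℕ (u B) <ᵇ toℕ (u A))

  ℓ-·s-as-∑ : ℓ (u ·s a) ≡ ∑∑ (λ i j → inversion (u ·s a) (gen a i) (gen a j))
  ℓ-·s-as-∑ = trans (ℓ-as-∑ (u ·s a))
    (trans (sum-permute (λ i → ∑ (inversion (u ·s a) i)) (Perm.transpose A B))
      (sum-cong-≗ (λ i → sum-permute (inversion (u ·s a) (gen a i)) (Perm.transpose A B))))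

  toℕ-B<ᵇtoℕ-A : (toℕ B <ᵇ toℕ A) ≡ false
  toℕ-B<ᵇtoℕ-A rewrite toℕ-inject₁ a = dec-false (suc (toℕ a) <? toℕ a) (<-asym (n<1+n (toℕ a)))

  toℕ-A<ᵇtoℕ-B : (toℕ A <ᵇ toℕ B) ≡ true
  toℕ-A<ᵇtoℕ-B rewrite toℕ-inject₁ a = dec-true (toℕ a <? suc (toℕ a)) (n<1+n (toℕ a))

  inversion-·s-away : ∀ i j → ¬ (i ≡ A × j ≡ B) → ¬ (i ≡ B × j ≡ A) →
    inversion (u ·s a) (gen a i) (gen a j) ≡ inversion u i j
  inversion-·s-away i j ¬AB ¬BA
    rewrite gen-involutive a i | gen-involutive a j | toℕ-gen a i | toℕ-gen a j
          | adjSwap-preserves-<ᵇ (toℕ a) (toℕ i) (toℕ j)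
              (λ (i≡a , j≡1+a) → ¬AB (toℕ-injective (trans i≡a (sym (toℕ-inject₁ a))) , toℕ-injective j≡1+a))
              (λ (i≡1+a , j≡a) → ¬BA (toℕ-injective i≡1+a , toℕ-injective (trans j≡a (sym (toℕ-inject₁ a)))))
    = refl

  inversion-·s-pointwise : ∀ i j →
    inversion (u ·s a) (gen a i) (gen a j) + δ² A B β i j ≡ inversion u i j + δ² B A α i j
  inversion-·s-pointwise i j with (i ≟ A) ×-dec (j ≟ B) | (i ≟ B) ×-dec (j ≟ A)
  ... | yes (refl , refl) | _
    rewrite gen-involutive a A | gen-involutive a B | gen-inject₁ a | gen-fsuc a
          | dec-true (A ≟ A) refl | dec-true (B ≟ B) refl | dec-false (A ≟ B) (fsuc≢inject₁ a ∘ sym)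
          | toℕ-B<ᵇtoℕ-A | toℕ-A<ᵇtoℕ-B = +-comm 0 β
  ... | no _ | yes (refl , refl)
    rewrite gen-involutive a A | gen-involutive a B | gen-inject₁ a | gen-fsuc a
          | dec-true (A ≟ A) refl | dec-true (B ≟ B) refl | dec-false (B ≟ A) (fsuc≢inject₁ a)
          | toℕ-B<ᵇtoℕ-A | toℕ-A<ᵇtoℕ-B = +-comm α 0
  ... | no ¬AB | no ¬BA
    rewrite inversion-·s-away i j ¬AB ¬BA | δ²-off A B β i j ¬AB | δ²-off B A α i j ¬BA = refl

  ℓ-·s-exchange : ℓ (u ·s a) + β ≡ ℓ u + α
  ℓ-·s-exchange = begin
    ℓ (u ·s a) + β
      ≡⟨ cong₂ _+_ ℓ-·s-as-∑ (sym (∑∑-δ² A B β)) ⟩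
    ∑∑ (λ i j → inversion (u ·s a) (gen a i) (gen a j)) + ∑∑ (δ² A B β)
      ≡⟨ ∑∑-distrib-+ (λ i j → inversion (u ·s a) (gen a i) (gen a j)) (δ² A B β) ⟨
    ∑∑ (λ i j → inversion (u ·s a) (gen a i) (gen a j) + δ² A B β i j)
      ≡⟨ ∑∑-cong inversion-·s-pointwise ⟩
    ∑∑ (λ i j → inversion u i j + δ² B A α i j)
      ≡⟨ ∑∑-distrib-+ (inversion u) (δ² B A α) ⟩
    ∑∑ (inversion u) + ∑∑ (δ² B A α)
      ≡⟨ cong₂ _+_ (sym (ℓ-as-∑ u)) (∑∑-δ² B A α) ⟩
    ℓ u + α ∎
    where open ≡-Reasoning

ℓ-·s-ascent : ∀ {m} (u : Elt m) a → Ascent u a → ℓ (u ·s a) ≡ suc (ℓ u)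
ℓ-·s-ascent u a asc = begin
  ℓ (u ·s a)     ≡⟨ +-identityʳ _ ⟨
  ℓ (u ·s a) + 0 ≡⟨ cong (λ b → ℓ (u ·s a) + 𝟙 b) (dec-false (_ <? _) (<-asym asc)) ⟨
  ℓ (u ·s a) + β ≡⟨ ℓ-·s-exchange ⟩
  ℓ u + α        ≡⟨ cong (λ b → ℓ u + 𝟙 b) (dec-true (_ <? _) asc) ⟩
  ℓ u + 1        ≡⟨ +-comm (ℓ u) 1 ⟩
  suc (ℓ u)      ∎
  where open ≡-Reasoning; open Exchange u a

ℓ-·s-descent : ∀ {m} (u : Elt m) a → ¬ Ascent u a → ℓ (u ·s a) ≤ ℓ u
ℓ-·s-descent u a ¬asc = subst (ℓ (u ·s a) ≤_)
  (trans ℓ-·s-exchange (trans (cong (λ b → ℓ u + 𝟙 b) (dec-false (_ <? _) ¬asc)) (+-identityʳ (ℓ u))))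
  (ℕ.m≤m+n (ℓ (u ·s a)) β)
  where open Exchange u a

ℓ<ᵇℓ-·s : ∀ {m} (u : Elt m) a → (ℓ u <ᵇ ℓ (u ·s a)) ≡ ascentᵇ u a
ℓ<ᵇℓ-·s u a with toℕ (u (inject₁ a)) <? toℕ (u (fsuc a))
... | yes asc = trans (dec-true (_ <? _) (subst (ℓ u <_) (sym (ℓ-·s-ascent u a asc)) (n<1+n (ℓ u))))
                    (sym (dec-true (_ <? _) asc))
... | no ¬asc = trans (dec-false (_ <? _) (ℕ.≤⇒≯ (ℓ-·s-descent u a ¬asc))) (sym (dec-false (_ <? _) ¬asc))

ℓ-cong : ∀ {m} {u v : Elt m} → u ≗ v → ℓ u ≡ ℓ v
ℓ-cong {m} {u} {v} u≗v = trans (ℓ-as-∑ u) (trans (∑∑-cong λ i j →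
  cong₂ (λ x y → 𝟙 ((toℕ i <ᵇ toℕ j) ∧ (toℕ x <ᵇ toℕ y))) (u≗v j) (u≗v i)) (sym (ℓ-as-∑ v)))

ℓ-id : ∀ {m} → ℓ {m} id ≡ 0
ℓ-id {m} = trans (ℓ-as-∑ {m} id)
  (trans (∑∑-cong {suc m} {inversion id} {λ _ _ → 0} (λ i j → cong 𝟙 (<ᵇ-asym (toℕ i) (toℕ j)))) (∑∑-zero (suc m)))
  where
  <ᵇ-asym : ∀ x y → (x <ᵇ y) ∧ (y <ᵇ x) ≡ false
  <ᵇ-asym x y with x <? y
  ... | yes x<y rewrite dec-false (y <? x) (<-asym x<y) = ∧-zeroʳ (x <ᵇ y)
  ... | no x≮y  = cong (_∧ (y <ᵇ x)) (dec-false (x <? y) x≮y)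

-- Parabolic elements and products of generators

LettersFrom : ∀ {m} → ℕ → List (Fin m) → Set
LettersFrom b = All (λ s → b ≤ toℕ s)

prod : ∀ {m} → List (Fin m) → Elt m
prod = foldl _·s_ id

FixesBelow : ∀ {m} → ℕ → Elt m → Set
FixesBelow b h = ∀ i → (toℕ i < b → h i ≡ i) × (b ≤ toℕ i → b ≤ toℕ (h i))

Parabolic : ∀ {m} → ℕ → Elt m → Set
Parabolic b h = FixesBelow b h × Injective _≡_ _≡_ h

FixesBelow-id : ∀ {m b} → FixesBelow {m} b id
FixesBelow-id i = (λ _ → refl) , id

FixesBelow-·s : ∀ {m b} {h : Elt m} {s} → FixesBelow b h → b ≤ toℕ s → FixesBelow b (h ·s s)
FixesBelow-·s {b = b} {h} {s} fix b≤s i = fixed , above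
  where
  fixed : toℕ i < b → h (gen s i) ≡ i
  fixed i<b rewrite gen-fixes s i (λ e → ℕ.<⇒≱ i<b (subst (b ≤_) (sym e) b≤s))
                                  (λ e → ℕ.<⇒≱ i<b (subst (b ≤_) (sym e) (≤-trans b≤s (n≤1+n _))))
    = proj₁ (fix i) i<b
  above : b ≤ toℕ i → b ≤ toℕ (h (gen s i))
  above b≤i = proj₂ (fix (gen s i)) (subst (b ≤_) (sym (toℕ-gen s i)) (adjSwap-preserves-≥ b≤s b≤i))

Parabolic-id : ∀ {m b} → Parabolic {m} b id
Parabolic-id = FixesBelow-id , id

Parabolic-·s : ∀ {m b} {h : Elt m} {s} → Parabolic b h → b ≤ toℕ s → Parabolic b (h ·s s)
Parabolic-·s {s = s} (fix , inj) b≤s = FixesBelow-·s fix b≤s ,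
  λ {i} {j} e → trans (sym (gen-involutive s i)) (trans (cong (gen s) (inj e)) (gen-involutive s j))

Parabolic-foldl : ∀ {m b} {h : Elt m} r → Parabolic b h → LettersFrom b r → Parabolic b (foldl _·s_ h r)
Parabolic-foldl []      par []         = par
Parabolic-foldl (s ∷ r) par (b≤s ∷ bs) = Parabolic-foldl r (Parabolic-·s par b≤s) bs

Parabolic-prod : ∀ {m b} (r : List (Fin m)) → LettersFrom b r → Parabolic b (prod r)
Parabolic-prod r = Parabolic-foldl r Parabolic-id

Parabolic-resp-≗ : ∀ {m b} {h g : Elt m} → h ≗ g → Parabolic b h → Parabolic b g
Parabolic-resp-≗ {b = b} h≗g (fix , inj) =
  (λ i → (λ i<b → trans (sym (h≗g i)) (proj₁ (fix i) i<b)) ,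
         (λ b≤i → subst (λ x → b ≤ toℕ x) (h≗g i) (proj₂ (fix i) b≤i))) ,
  λ e → inj (trans (h≗g _) (trans e (sym (h≗g _))))

gen-preserves-<ᵇ : ∀ {m} (a : Fin m) p q → suc (toℕ a) ≤ toℕ p → suc (toℕ a) ≤ toℕ q →
  (toℕ (gen a p) <ᵇ toℕ (gen a q)) ≡ (toℕ p <ᵇ toℕ q)
gen-preserves-<ᵇ a p q a<p a<q rewrite toℕ-gen a p | toℕ-gen a q =
  adjSwap-preserves-<ᵇ (toℕ a) (toℕ p) (toℕ q)
    (λ (p≡a , _) → <-irrefl (sym p≡a) a<p) (λ (_ , q≡a) → <-irrefl (sym q≡a) a<q)

-- s_a does not reorder values above a, so h and s_a ∘ h have the same ascents at letters above a.
ℓ-gen∘-·s : ∀ {m} (a : Fin m) {h : Elt m} {s} → FixesBelow (suc (toℕ a)) h → suc (toℕ a) ≤ toℕ s →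
  ℓ (gen a ∘ h) ≡ suc (ℓ h) → ℓ (gen a ∘ (h ·s s)) ≡ suc (ℓ (h ·s s))
ℓ-gen∘-·s a {h} {s} fix a<s ℓσh = ℕ.+-cancelʳ-≡ (E.β h) _ _ (begin
  ℓ (gen a ∘ h ·s s) + E.β h     ≡⟨ cong (λ x → ℓ (gen a ∘ h ·s s) + 𝟙 x) (gen-preserves-<ᵇ a _ _ hB hA) ⟨
  ℓ (gen a ∘ h ·s s) + E.β (gen a ∘ h) ≡⟨ E.ℓ-·s-exchange (gen a ∘ h) ⟩
  ℓ (gen a ∘ h) + E.α (gen a ∘ h) ≡⟨ cong₂ (λ x y → x + 𝟙 y) ℓσh (gen-preserves-<ᵇ a _ _ hA hB) ⟩
  suc (ℓ h + E.α h)             ≡⟨ cong suc (E.ℓ-·s-exchange h) ⟨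
  suc (ℓ (h ·s s) + E.β h)      ∎)
  where
  open ≡-Reasoning
  module E (u : Elt _) = Exchange u s
  hA : suc (toℕ a) ≤ toℕ (h (inject₁ s))
  hA = proj₂ (fix (inject₁ s)) (subst (suc (toℕ a) ≤_) (sym (toℕ-inject₁ s)) a<s)
  hB : suc (toℕ a) ≤ toℕ (h (fsuc s))
  hB = proj₂ (fix (fsuc s)) (≤-trans a<s (n≤1+n _))

FixesBelow⇒Ascent : ∀ {m} (a : Fin m) {h : Elt m} → FixesBelow (suc (toℕ a)) h → Ascent h a
FixesBelow⇒Ascent a {h} fix = subst (_< toℕ (h (fsuc a))) (sym hA≡a) (proj₂ (fix (fsuc a)) ≤-refl)
  where
  hA≡a : toℕ (h (inject₁ a)) ≡ toℕ a
  hA≡a = trans (cong toℕ (proj₁ (fix (inject₁ a)) (subst (_< suc (toℕ a)) (sym (toℕ-inject₁ a)) (n<1+n _))))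
               (toℕ-inject₁ a)

ℓ-gen∘foldl : ∀ {m} (a : Fin m) {h : Elt m} r → FixesBelow (suc (toℕ a)) h → LettersFrom (suc (toℕ a)) r →
  ℓ (gen a ∘ h) ≡ suc (ℓ h) → ℓ (gen a ∘ foldl _·s_ h r) ≡ suc (ℓ (foldl _·s_ h r))
ℓ-gen∘foldl a []      fix []         ℓσh = ℓσh
ℓ-gen∘foldl a (s ∷ r) fix (a<s ∷ as) ℓσh =
  ℓ-gen∘foldl a r (FixesBelow-·s fix a<s) as (ℓ-gen∘-·s a fix a<s ℓσh)

ℓ-gen∘prod : ∀ {m} (a : Fin m) r → LettersFrom (suc (toℕ a)) r → ℓ (gen a ∘ prod r) ≡ suc (ℓ (prod r))
ℓ-gen∘prod a r as = ℓ-gen∘foldl a r FixesBelow-id as (ℓ-·s-ascent id a (FixesBelow⇒Ascent a FixesBelow-id))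

IsProduct : ∀ {m} → ℕ → Elt m → Set
IsProduct b g = ∃[ r ] LettersFrom b r × prod r ≗ g

IsProduct-resp-≗ : ∀ {m b} {h g : Elt m} → h ≗ g → IsProduct b h → IsProduct b g
IsProduct-resp-≗ h≗g (r , bs , r≗h) = r , bs , λ i → trans (r≗h i) (h≗g i)

IsProduct-weaken : ∀ {m b c} {g : Elt m} → b ≤ c → IsProduct c g → IsProduct b g
IsProduct-weaken b≤c (r , cs , r≗g) = r , All.map (≤-trans b≤c) cs , r≗g

IsProduct⇒Parabolic : ∀ {m b} {g : Elt m} → IsProduct b g → Parabolic b g
IsProduct⇒Parabolic (r , bs , r≗g) = Parabolic-resp-≗ r≗g (Parabolic-prod r bs)

foldl-·s-∘ : ∀ {m} (f h : Elt m) r → foldl _·s_ (f ∘ h) r ≡ f ∘ foldl _·s_ h r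
foldl-·s-∘ f h []      = refl
foldl-·s-∘ f h (s ∷ r) = foldl-·s-∘ f (h ·s s) r

IsProduct-·s : ∀ {m b} {h : Elt m} {a} → b ≤ toℕ a → IsProduct b h → Ascent h a →
  IsProduct b (h ·s a) × ℓ (h ·s a) ≡ suc (ℓ h)
IsProduct-·s {h = h} {a} b≤a (r , bs , r≗h) asc =
  (r ∷ʳ a , ∷ʳ⁺ bs b≤a , λ i → trans (cong (λ f → f i) (foldl-∷ʳ _·s_ id a r)) (r≗h (gen a i))) ,
  ℓ-·s-ascent h a asc

IsProduct-gen∘ : ∀ {m b} {h : Elt m} (a : Fin m) → b ≤ toℕ a → IsProduct (suc (toℕ a)) h →
  IsProduct b (gen a ∘ h) × ℓ (gen a ∘ h) ≡ suc (ℓ h)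
IsProduct-gen∘ {h = h} a b≤a (r , as , r≗h) =
  (a ∷ r , b≤a ∷ All.map (≤-trans (≤-trans b≤a (n≤1+n _))) as ,
   λ i → trans (cong (λ f → f i) (foldl-·s-∘ (gen a) id r)) (cong (gen a) (r≗h i))) ,
  trans (ℓ-cong (λ i → cong (gen a) (sym (r≗h i)))) (trans (ℓ-gen∘prod a r as) (cong suc (ℓ-cong r≗h)))

-- Polynomials in t

shift : Poly → Poly
shift p zero    = 0
shift p (suc d) = p d

shift-cong : ∀ {p q} → p ≗ q → shift p ≗ shift q
shift-cong p≗q zero    = refl
shift-cong p≗q (suc d) = p≗q d

shift-0ₚ : shift 0ₚ ≗ 0ₚ
shift-0ₚ zero    = refl
shift-0ₚ (suc d) = refl

shift-⊕ : ∀ p q → shift (p ⊕ q) ≗ shift p ⊕ shift q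
shift-⊕ p q zero    = refl
shift-⊕ p q (suc d) = refl

shift-vanishes : ∀ {p} → p ≗ 0ₚ → shift p ≗ 0ₚ
shift-vanishes p≗0 d = trans (shift-cong p≗0 d) (shift-0ₚ d)

⊕-vanishesˡ : ∀ {p q} → p ≗ 0ₚ → p ⊕ q ≗ q
⊕-vanishesˡ p≗0 d = cong (_+ _) (p≗0 d)

⊕-vanishesʳ : ∀ {p q} → q ≗ 0ₚ → p ⊕ q ≗ p
⊕-vanishesʳ {p} q≗0 d = trans (cong (p d +_) (q≗0 d)) (+-identityʳ (p d))

module ≗-Reasoning = SetoidReasoning (ℕ →-setoid ℕ)

≗-trans : ∀ {p q r : Poly} → p ≗ q → q ≗ r → p ≗ r
≗-trans p≗q q≗r d = trans (p≗q d) (q≗r d)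

⊕-cong : ∀ {p p′ q q′} → p ≗ p′ → q ≗ q′ → p ⊕ q ≗ p′ ⊕ q′
⊕-cong p≗p′ q≗q′ d = cong₂ _+_ (p≗p′ d) (q≗q′ d)

when : Bool → Poly → Poly
when b p = if b then p else 0ₚ

when-vanishes : ∀ b {p} → p ≗ 0ₚ → when b p ≗ 0ₚ
when-vanishes true  p≗0 = p≗0
when-vanishes false p≗0 d = refl

when-cong : ∀ b {p q} → p ≗ q → when b p ≗ when b q
when-cong true  p≗q = p≗q
when-cong false p≗q d = refl

when-⊕ : ∀ b p q → when b (p ⊕ q) ≗ when b p ⊕ when b q
when-⊕ true  p q d = refl
when-⊕ false p q d = refl

sum-applyUpTo-+ : ∀ n (f g : ℕ → ℕ) → sum (applyUpTo (λ i → f i + g i) n) ≡ sum (applyUpTo f n) + sum (applyUpTo g n)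
sum-applyUpTo-+ zero    f g = refl
sum-applyUpTo-+ (suc n) f g = trans (cong (f 0 + g 0 +_) (sum-applyUpTo-+ n (f ∘ suc) (g ∘ suc)))
  (+-interchange (f 0) (g 0) _ _)

applyUpTo-cong : ∀ {A : Set} {f g : ℕ → A} → f ≗ g → ∀ n → applyUpTo f n ≡ applyUpTo g n
applyUpTo-cong f≗g zero    = refl
applyUpTo-cong f≗g (suc n) = cong₂ _∷_ (f≗g 0) (applyUpTo-cong (f≗g ∘ suc) n)

sum-applyUpTo-zero : ∀ n → sum (applyUpTo (λ _ → 0) n) ≡ 0
sum-applyUpTo-zero zero    = refl
sum-applyUpTo-zero (suc n) = sum-applyUpTo-zero n

sum-applyUpTo-t^ : ∀ n c (f : ℕ → ℕ) → sum (applyUpTo (λ i → t^ c i * f i) n) ≡ (if c <ᵇ n then f c else 0)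
sum-applyUpTo-t^ zero    c       f = refl
sum-applyUpTo-t^ (suc n) zero    f = trans (cong (f 0 + 0 +_) (sum-applyUpTo-zero n)) (trans (+-identityʳ _) (+-identityʳ _))
sum-applyUpTo-t^ (suc n) (suc c) f = sum-applyUpTo-t^ n c (f ∘ suc)

⊛-as-applyUpTo : ∀ p q d → (p ⊛ q) d ≡ sum (applyUpTo (λ i → p i * q (d ∸ i)) (suc d))
⊛-as-applyUpTo p q d = cong sum (map-applyUpTo id (λ i → p i * q (d ∸ i)) (suc d))

t^-⊛ : ∀ c p d → (t^ c ⊛ p) d ≡ (if c <ᵇ suc d then p (d ∸ c) else 0)
t^-⊛ c p d = trans (⊛-as-applyUpTo (t^ c) p d) (sum-applyUpTo-t^ (suc d) c (λ i → p (d ∸ i)))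

t^0-⊛ : ∀ p → t^ 0 ⊛ p ≗ p
t^0-⊛ p = t^-⊛ 0 p

t^suc-⊛ : ∀ c p → t^ (suc c) ⊛ p ≗ shift (t^ c ⊛ p)
t^suc-⊛ c p zero    = t^-⊛ (suc c) p 0
t^suc-⊛ c p (suc d) = trans (t^-⊛ (suc c) p (suc d)) (sym (t^-⊛ c p d))

⊛-distribʳ-⊕ : ∀ p q r → (p ⊕ q) ⊛ r ≗ (p ⊛ r) ⊕ (q ⊛ r)
⊛-distribʳ-⊕ p q r d = begin
  ((p ⊕ q) ⊛ r) d
    ≡⟨ ⊛-as-applyUpTo (p ⊕ q) r d ⟩
  sum (applyUpTo (λ i → (p i + q i) * r (d ∸ i)) (suc d))
    ≡⟨ cong sum (applyUpTo-cong (λ i → ℕ.*-distribʳ-+ (r (d ∸ i)) (p i) (q i)) (suc d)) ⟩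
  sum (applyUpTo (λ i → p i * r (d ∸ i) + q i * r (d ∸ i)) (suc d))
    ≡⟨ sum-applyUpTo-+ (suc d) (λ i → p i * r (d ∸ i)) (λ i → q i * r (d ∸ i)) ⟩
  sum (applyUpTo (λ i → p i * r (d ∸ i)) (suc d)) + sum (applyUpTo (λ i → q i * r (d ∸ i)) (suc d))
    ≡⟨ cong₂ _+_ (⊛-as-applyUpTo p r d) (⊛-as-applyUpTo q r d) ⟨
  ((p ⊛ r) ⊕ (q ⊛ r)) d ∎
  where open ≡-Reasoning

[t²+1]-⊛ : ∀ p → (t^ 2 ⊕ t^ 0) ⊛ p ≗ shift (shift p) ⊕ p
[t²+1]-⊛ p d = trans (⊛-distribʳ-⊕ (t^ 2) (t^ 0) p d) (cong₂ _+_ t²p t^0p)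
  where
  t²p : (t^ 2 ⊛ p) d ≡ shift (shift p) d
  t²p = trans (t^suc-⊛ 1 p d) (shift-cong (λ e → trans (t^suc-⊛ 0 p e) (shift-cong (t^0-⊛ p) e)) d)
  t^0p : (t^ 0 ⊛ p) d ≡ p d
  t^0p = t^0-⊛ p d

tᶜ[t²+1]ᵏ : ℕ → ℕ → Poly
tᶜ[t²+1]ᵏ c k = t^ c ⊛ ((t^ 2 ⊕ t^ 0) ^ₚ k)

tᶜ[t²+1]ᵏ-suc-c : ∀ c k → tᶜ[t²+1]ᵏ (suc c) k ≗ shift (tᶜ[t²+1]ᵏ c k)
tᶜ[t²+1]ᵏ-suc-c c k = t^suc-⊛ c _

tᶜ[t²+1]ᵏ-suc-k : ∀ c k → tᶜ[t²+1]ᵏ c (suc k) ≗ tᶜ[t²+1]ᵏ c k ⊕ shift (shift (tᶜ[t²+1]ᵏ c k))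
tᶜ[t²+1]ᵏ-suc-k zero    k d = begin
  tᶜ[t²+1]ᵏ 0 (suc k) d                            ≡⟨ t^0-⊛ ((t^ 2 ⊕ t^ 0) ⊛ Q) d ⟩
  ((t^ 2 ⊕ t^ 0) ⊛ Q) d                            ≡⟨ [t²+1]-⊛ Q d ⟩
  shift (shift Q) d + Q d                          ≡⟨ +-comm _ (Q d) ⟩
  Q d + shift (shift Q) d                          ≡⟨ cong₂ _+_ (t^0-⊛ Q d) (shift-cong (shift-cong (t^0-⊛ Q)) d) ⟨
  (tᶜ[t²+1]ᵏ 0 k ⊕ shift (shift (tᶜ[t²+1]ᵏ 0 k))) d ∎
  where
  open ≡-Reasoning
  Q = (t^ 2 ⊕ t^ 0) ^ₚ k
tᶜ[t²+1]ᵏ-suc-k (suc c) k d = begin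
  tᶜ[t²+1]ᵏ (suc c) (suc k) d             ≡⟨ tᶜ[t²+1]ᵏ-suc-c c (suc k) d ⟩
  shift (tᶜ[t²+1]ᵏ c (suc k)) d           ≡⟨ shift-cong (tᶜ[t²+1]ᵏ-suc-k c k) d ⟩
  shift (P ⊕ shift (shift P)) d           ≡⟨ shift-⊕ P (shift (shift P)) d ⟩
  shift P d + shift (shift (shift P)) d
    ≡⟨ cong₂ _+_ (tᶜ[t²+1]ᵏ-suc-c c k d) (shift-cong (shift-cong (tᶜ[t²+1]ᵏ-suc-c c k)) d) ⟨
  (tᶜ[t²+1]ᵏ (suc c) k ⊕ shift (shift (tᶜ[t²+1]ᵏ (suc c) k))) d ∎
  where
  open ≡-Reasoning
  P = tᶜ[t²+1]ᵏ c k

-- Counting the leaves of the light-leaves tree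

weight : ∀ {m} → Elt m → Node m → Poly
weight g (x , e) = if does (all? (λ i → x i ≟ g i)) then t^ e else 0ₚ

count : ∀ {m} → Elt m → List (Node m) → Poly
count g []       = 0ₚ
count g (nd ∷ L) = weight g nd ⊕ count g L

weight-resp : ∀ {m} {g g′ x x′ : Elt m} e → (x ≗ g → x′ ≗ g′) → (x′ ≗ g′ → x ≗ g) →
  weight g (x , e) ≡ weight g′ (x′ , e)
weight-resp {g = g} {g′} {x} {x′} e to from
  rewrite does-⇔ (mk⇔ to from) (all? (λ i → x i ≟ g i)) (all? (λ i → x′ i ≟ g′ i)) = refl

weight-match : ∀ {m} {g x : Elt m} e → x ≗ g → weight g (x , e) ≗ t^ e
weight-match {g = g} {x} e x≗g d = cong (λ b → (if b then t^ e else 0ₚ) d) (dec-true (all? (λ i → x i ≟ g i)) x≗g)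

weight-mismatch : ∀ {m} {g x : Elt m} e → ¬ x ≗ g → weight g (x , e) ≗ 0ₚ
weight-mismatch {g = g} {x} e x≉g d = cong (λ b → (if b then t^ e else 0ₚ) d) (dec-false (all? (λ i → x i ≟ g i)) x≉g)

weight-raise : ∀ {m} (g x : Elt m) e → weight g (x , suc e) ≗ shift (weight g (x , e))
weight-raise g x e = raise-if (does (all? (λ i → x i ≟ g i)))
  where
  raise-if : ∀ b → (if b then t^ (suc e) else 0ₚ) ≗ shift (if b then t^ e else 0ₚ)
  raise-if true  zero    = refl
  raise-if true  (suc d) = refl
  raise-if false zero    = refl
  raise-if false (suc d) = refl

count-++ : ∀ {m} (g : Elt m) L₁ L₂ → count g (L₁ ++ L₂) ≗ count g L₁ ⊕ count g L₂
count-++ g []        L₂ d = refl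
count-++ g (nd ∷ L₁) L₂ d = trans (cong (weight g nd d +_) (count-++ g L₁ L₂ d)) (sym (+-assoc (weight g nd d) _ _))

NodesIn : ∀ {m} → (Elt m → Set) → List (Node m) → Set
NodesIn P = All (P ∘ proj₁)

count-vanishes : ∀ {m} {P : Elt m → Set} {g : Elt m} L → NodesIn P L → (∀ x → P x → ¬ x ≗ g) → count g L ≗ 0ₚ
count-vanishes []             []       never d = refl
count-vanishes ((x , e) ∷ L) (px ∷ ps) never d =
  cong₂ _+_ (weight-mismatch e (never x px) d) (count-vanishes L ps never d)

count-agree : ∀ {m} {P : Elt m → Set} {g h : Elt m} L → NodesIn P L →
  (∀ x → P x → x ≗ g → x ≗ h) → (∀ x → P x → x ≗ h → x ≗ g) → count g L ≗ count h L
count-agree []             []        to from d = refl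
count-agree ((x , e) ∷ L) (px ∷ ps) to from d =
  cong₂ _+_ (cong (λ p → p d) (weight-resp e (to x px) (from x px))) (count-agree L ps to from d)

raise : ∀ {m} → Node m → Node m
raise (x , e) = x , suc e

mulˡ : ∀ {m} → Fin m → Node m → Node m
mulˡ a (x , e) = gen a ∘ x , e

grow : ∀ {m} → List (Fin m) → List (Node m) → List (Node m)
grow w L = foldl (λ nodes s → concatMap (children s) nodes) L w

grow-++ : ∀ {m} (w : List (Fin m)) L₁ L₂ → grow w (L₁ ++ L₂) ≡ grow w L₁ ++ grow w L₂
grow-++ []      L₁ L₂ = refl
grow-++ (s ∷ w) L₁ L₂ = trans (cong (grow w) (concatMap-++ (children s) L₁ L₂)) (grow-++ w _ _)

module _ {m} {P : Node m → Set} {Q : Fin m → Set}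
         (children-P : ∀ {s nd} → Q s → P nd → All P (children s nd)) where

  concatMap-children-All : ∀ {s} L → Q s → All P L → All P (concatMap (children s) L)
  concatMap-children-All L qs ps = concat⁺ (map⁺ (All.map (children-P qs) ps))

  grow-All : ∀ w L → All Q w → All P L → All P (grow w L)
  grow-All []      L []         ps = ps
  grow-All (s ∷ w) L (qs ∷ qw) ps = grow-All w _ qw (concatMap-children-All L qs ps)

  grow-map-commute : (f : Node m → Node m) → (∀ {s nd} → Q s → P nd → children s (f nd) ≡ map f (children s nd)) →
    ∀ w L → All Q w → All P L → grow w (map f L) ≡ map f (grow w L)
  grow-map-commute f children-f []      L []         ps = refl
  grow-map-commute f children-f (s ∷ w) L (qs ∷ qw) ps =
    trans (cong (grow w) (concatMap-map L ps)) (grow-map-commute f children-f w _ qw (concatMap-children-All L qs ps))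
    where
    concatMap-map : ∀ L → All P L → concatMap (children s) (map f L) ≡ map f (concatMap (children s) L)
    concatMap-map []       []       = refl
    concatMap-map (nd ∷ L) (p ∷ ps) =
      trans (cong₂ _++_ (children-f qs p) (concatMap-map L ps)) (sym (map-++ f (children s nd) _))

children-raise : ∀ {m} (s : Fin m) nd → children s (raise nd) ≡ map raise (children s nd)
children-raise s (x , e) with ℓ x <ᵇ ℓ (x ·s s)
... | true  = refl
... | false = refl

grow-map-raise : ∀ {m} (w : List (Fin m)) L → grow w (map raise L) ≡ map raise (grow w L)
grow-map-raise w L = grow-map-commute {P = U} {Q = U} (λ _ _ → universal-U _) raise (λ {s} {nd} _ _ → children-raise s nd)
  w L (universal-U w) (universal-U L)

children-Parabolic : ∀ {m b} {s : Fin m} {x e} → b ≤ toℕ s → Parabolic b x → NodesIn (Parabolic b) (children s (x , e))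
children-Parabolic {s = s} {x} b≤s par with ℓ x <ᵇ ℓ (x ·s s)
... | true  = Parabolic-·s par b≤s ∷ par ∷ []
... | false = Parabolic-·s par b≤s ∷ []

leaves-Parabolic : ∀ {m b} (w : List (Fin m)) → LettersFrom b w → NodesIn (Parabolic b) (leaves w)
leaves-Parabolic w bw = grow-All (λ b≤s par → children-Parabolic b≤s par) w _ bw (Parabolic-id ∷ [])

children-mulˡ : ∀ {m} (a : Fin m) {s x} e → suc (toℕ a) ≤ toℕ s → FixesBelow (suc (toℕ a)) x →
  children s (mulˡ a (x , e)) ≡ map (mulˡ a) (children s (x , e))
children-mulˡ a {s} {x} e a<s fix
  rewrite ℓ<ᵇℓ-·s (gen a ∘ x) s | ℓ<ᵇℓ-·s x s
        | gen-preserves-<ᵇ a (x (inject₁ s)) (x (fsuc s))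
            (proj₂ (fix (inject₁ s)) (subst (suc (toℕ a) ≤_) (sym (toℕ-inject₁ s)) a<s))
            (proj₂ (fix (fsuc s)) (≤-trans a<s (n≤1+n _)))
  with toℕ (x (inject₁ s)) <ᵇ toℕ (x (fsuc s))
... | true  = refl
... | false = refl

leaves-cons : ∀ {m} (a : Fin m) w → LettersFrom (suc (toℕ a)) w →
  leaves (a ∷ w) ≡ map (mulˡ a) (leaves w) ++ map raise (leaves w)
leaves-cons a w aw = begin
  grow w (children a (id , 0) ++ [])
    ≡⟨ cong (λ b → grow w ((if b then (gen a , 0) ∷ (id , 1) ∷ [] else (gen a , 0) ∷ []) ++ []))
            (trans (ℓ<ᵇℓ-·s id a) (dec-true (_ <? _) (FixesBelow⇒Ascent a FixesBelow-id))) ⟩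
  grow w (map (mulˡ a) [ id , 0 ] ++ map raise [ id , 0 ])
    ≡⟨ grow-++ w _ _ ⟩
  grow w (map (mulˡ a) [ id , 0 ]) ++ grow w (map raise [ id , 0 ])
    ≡⟨ cong₂ _++_ (grow-map-commute (λ a<s par → children-Parabolic a<s par) (mulˡ a)
                    (λ a<s par → children-mulˡ a _ a<s (proj₁ par)) w _ aw (Parabolic-id ∷ []))
                  (grow-map-raise w _) ⟩
  map (mulˡ a) (leaves w) ++ map raise (leaves w) ∎
  where open ≡-Reasoning

leaves-snoc : ∀ {m} (w : List (Fin m)) a → leaves (w ++ [ a ]) ≡ concatMap (children a) (leaves w)
leaves-snoc w a = foldl-∷ʳ (λ nodes s → concatMap (children s) nodes) _ a w

count-map-raise : ∀ {m} (g : Elt m) L → count g (map raise L) ≗ shift (count g L)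
count-map-raise g []            zero    = refl
count-map-raise g []            (suc d) = refl
count-map-raise g ((x , e) ∷ L) d =
  trans (cong₂ _+_ (weight-raise g x e d) (count-map-raise g L d)) (sym (shift-⊕ (weight g (x , e)) (count g L) d))

count-map-mulˡ : ∀ {m} (a : Fin m) (g : Elt m) L → count g (map (mulˡ a) L) ≗ count (gen a ∘ g) L
count-map-mulˡ a g []            d = refl
count-map-mulˡ a g ((x , e) ∷ L) d = cong₂ _+_
  (cong (λ p → p d) (weight-resp e (λ σx≗g i → trans (sym (gen-involutive a (x i))) (cong (gen a) (σx≗g i)))
                                    (λ x≗σg i → trans (cong (gen a) (x≗σg i)) (gen-involutive a (g i)))))
  (count-map-mulˡ a g L d)

weight-·s : ∀ {m} (a : Fin m) (g x : Elt m) e → weight g (x ·s a , e) ≡ weight (g ∘ gen a) (x , e)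
weight-·s a g x e = weight-resp e
  (λ xσ≗g i → trans (cong x (sym (gen-involutive a i))) (xσ≗g (gen a i)))
  (λ x≗gσ i → trans (x≗gσ (gen a i)) (cong g (gen-involutive a i)))

-- A leaf x matching g has an ascent at a exactly when g does, so the dotted child's share depends on g alone.
count-children : ∀ {m} (a : Fin m) (g x : Elt m) e →
  count g (children a (x , e)) ≗ weight (g ∘ gen a) (x , e) ⊕ when (ascentᵇ g a) (shift (weight g (x , e)))
count-children a g x e d = begin
  count g (children a (x , e)) d
    ≡⟨ cong (λ b → count g (offspring b) d) (ℓ<ᵇℓ-·s x a) ⟩
  count g (offspring (ascentᵇ x a)) d
    ≡⟨ count-offspring (ascentᵇ x a) ⟩
  weight g (x ·s a , e) d + when (ascentᵇ x a) (weight g (x , suc e)) d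
    ≡⟨ cong₂ _+_ (cong (λ p → p d) (weight-·s a g x e)) (dotted-leaf (all? (λ i → x i ≟ g i))) ⟩
  weight (g ∘ gen a) (x , e) d + when (ascentᵇ g a) (shift (weight g (x , e))) d ∎
  where
  open ≡-Reasoning
  offspring : Bool → List (Node _)
  offspring b = if b then (x ·s a , e) ∷ (x , suc e) ∷ [] else (x ·s a , e) ∷ []

  count-offspring : ∀ b → count g (offspring b) d ≡ weight g (x ·s a , e) d + when b (weight g (x , suc e)) d
  count-offspring true  = cong (weight g (x ·s a , e) d +_) (+-identityʳ _)
  count-offspring false = refl

  dotted-leaf : Dec (x ≗ g) → when (ascentᵇ x a) (weight g (x , suc e)) d ≡ when (ascentᵇ g a) (shift (weight g (x , e))) d
  dotted-leaf (yes x≗g) =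
    trans (cong (λ b → when b (weight g (x , suc e)) d) (cong₂ (λ p q → toℕ p <ᵇ toℕ q) (x≗g (inject₁ a)) (x≗g (fsuc a))))
          (when-cong (ascentᵇ g a) (weight-raise g x e) d)
  dotted-leaf (no x≉g)  = trans (when-vanishes (ascentᵇ x a) (weight-mismatch (suc e) x≉g) d)
                                (sym (when-vanishes (ascentᵇ g a) (shift-vanishes (weight-mismatch e x≉g)) d))

count-concatMap-children : ∀ {m} (a : Fin m) g L →
  count g (concatMap (children a) L) ≗ count (g ∘ gen a) L ⊕ when (ascentᵇ g a) (shift (count g L))
count-concatMap-children a g []       d = sym (when-vanishes (ascentᵇ g a) shift-0ₚ d)
count-concatMap-children a g (nd ∷ L) d = begin
  count g (children a nd ++ concatMap (children a) L) d
    ≡⟨ count-++ g (children a nd) _ d ⟩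
  count g (children a nd) d + count g (concatMap (children a) L) d
    ≡⟨ cong₂ _+_ (count-children a g (proj₁ nd) (proj₂ nd) d) (count-concatMap-children a g L d) ⟩
  (weight (g ∘ gen a) nd d + when b (shift (weight g nd)) d) + (count (g ∘ gen a) L d + when b (shift (count g L)) d)
    ≡⟨ +-interchange (weight (g ∘ gen a) nd d) (when b (shift (weight g nd)) d) (count (g ∘ gen a) L d) _ ⟩
  count (g ∘ gen a) (nd ∷ L) d + (when b (shift (weight g nd)) d + when b (shift (count g L)) d)
    ≡⟨ cong (count (g ∘ gen a) (nd ∷ L) d +_)
            (trans (when-cong b (shift-⊕ (weight g nd) (count g L)) d)
                   (when-⊕ b (shift (weight g nd)) (shift (count g L)) d)) ⟨
  count (g ∘ gen a) (nd ∷ L) d + when b (shift (count g (nd ∷ L))) d ∎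
  where
  open ≡-Reasoning
  b = ascentᵇ g a

count-leaves-cons : ∀ {m} (a : Fin m) g w → LettersFrom (suc (toℕ a)) w →
  count g (leaves (a ∷ w)) ≗ count (gen a ∘ g) (leaves w) ⊕ shift (count g (leaves w))
count-leaves-cons a g w aw d = begin
  count g (leaves (a ∷ w)) d                                        ≡⟨ cong (λ L → count g L d) (leaves-cons a w aw) ⟩
  count g (map (mulˡ a) (leaves w) ++ map raise (leaves w)) d       ≡⟨ count-++ g (map (mulˡ a) (leaves w)) _ d ⟩
  count g (map (mulˡ a) (leaves w)) d + count g (map raise (leaves w)) d
    ≡⟨ cong₂ _+_ (count-map-mulˡ a g (leaves w) d) (count-map-raise g (leaves w) d) ⟩
  count (gen a ∘ g) (leaves w) d + shift (count g (leaves w)) d    ∎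
  where open ≡-Reasoning

count-leaves-snoc : ∀ {m} (a : Fin m) g w →
  count g (leaves (w ++ [ a ])) ≗ count (g ∘ gen a) (leaves w) ⊕ when (ascentᵇ g a) (shift (count g (leaves w)))
count-leaves-snoc a g w d = trans (cong (λ L → count g L d) (leaves-snoc w a)) (count-concatMap-children a g (leaves w) d)

-- The induction over nested words

Shaped : ∀ {m} → ℕ → ℕ → Elt m → Poly → Set
Shaped b n g p = p ≗ 0ₚ ⊎ (IsProduct b g × ∃[ c ] ∃[ k ] (2 * k + c + ℓ g ≡ n × p ≗ tᶜ[t²+1]ᵏ c k))

Shaped-≗ : ∀ {m b n} {g : Elt m} {p q} → p ≗ q → Shaped b n g q → Shaped b n g p
Shaped-≗ p≗q (inj₁ q≗0)                       = inj₁ (≗-trans p≗q q≗0)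
Shaped-≗ p≗q (inj₂ (prod , c , k , len , q≗)) = inj₂ (prod , c , k , len , ≗-trans p≗q q≗)

Shaped-weaken : ∀ {m b b′ n} {g : Elt m} {p} → b ≤ b′ → Shaped b′ n g p → Shaped b n g p
Shaped-weaken b≤b′ (inj₁ p≗0)                     = inj₁ p≗0
Shaped-weaken b≤b′ (inj₂ (prod , c , k , len , p≗)) = inj₂ (IsProduct-weaken b≤b′ prod , c , k , len , p≗)

Shaped-shift : ∀ {m b n} {g : Elt m} {p} → Shaped b n g p → Shaped b (suc n) g (shift p)
Shaped-shift (inj₁ p≗0) = inj₁ (shift-vanishes p≗0)
Shaped-shift {g = g} (inj₂ (prod , c , k , len , p≗)) =
  inj₂ (prod , suc c , k , trans (cong (_+ ℓ g) (+-suc (2 * k) c)) (cong suc len) ,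
        λ d → trans (shift-cong p≗ d) (sym (tᶜ[t²+1]ᵏ-suc-c c k d)))

Shaped-[t²+1] : ∀ {m b n} {g : Elt m} {p} → Shaped b n g p → Shaped b (2 + n) g (p ⊕ shift (shift p))
Shaped-[t²+1] (inj₁ p≗0) = inj₁ (⊕-cong p≗0 (shift-vanishes (shift-vanishes p≗0)))
Shaped-[t²+1] {g = g} (inj₂ (prod , c , k , len , p≗)) =
  inj₂ (prod , c , suc k , trans (cong (λ x → x + c + ℓ g) (ℕ.*-suc 2 k)) (cong (2 +_) len) ,
        λ d → trans (cong₂ _+_ (p≗ d) (shift-cong (shift-cong p≗) d)) (sym (tᶜ[t²+1]ᵏ-suc-k c k d)))

Shaped-transport : ∀ {m b b′ n j} {g g′ h : Elt m} {p} → g′ ≗ g →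
  (IsProduct b′ h → IsProduct b g′ × ℓ g′ ≡ j + ℓ h) → Shaped b′ n h p → Shaped b (j + n) g p
Shaped-transport g′≗g step (inj₁ p≗0) = inj₁ p≗0
Shaped-transport {n = n} {j} {g} {g′} {h} g′≗g step (inj₂ (prod , c , k , len , p≗)) with step prod
... | prod′ , ℓg′ = inj₂ (IsProduct-resp-≗ g′≗g prod′ , c , k , len′ , p≗)
  where
  len′ : 2 * k + c + ℓ g ≡ j + n
  len′ = begin
    2 * k + c + ℓ g       ≡⟨ cong (2 * k + c +_) (trans (ℓ-cong (λ i → sym (g′≗g i))) ℓg′) ⟩
    2 * k + c + (j + ℓ h) ≡⟨ x∙yz≈y∙xz (2 * k + c) j (ℓ h) ⟩
    j + (2 * k + c + ℓ h) ≡⟨ cong (j +_) len ⟩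
    j + n                 ∎
    where open ≡-Reasoning

when-ascent-redundant : ∀ {m} {g : Elt m} {a p} → (¬ Ascent g a → p ≗ 0ₚ) → when (ascentᵇ g a) p ≗ p
when-ascent-redundant {g = g} {a} {p} vanish d with toℕ (g (inject₁ a)) <? toℕ (g (fsuc a))
... | yes asc = cong (λ b → when b p d) (dec-true (_ <? _) asc)
... | no ¬asc = trans (cong (λ b → when b p d) (dec-false (_ <? _) ¬asc)) (sym (vanish ¬asc d))

when-ascent-vanishes : ∀ {m} {g : Elt m} {a p} → (Ascent g a → p ≗ 0ₚ) → when (ascentᵇ g a) p ≗ 0ₚ
when-ascent-vanishes {g = g} {a} {p} vanish d with toℕ (g (inject₁ a)) <? toℕ (g (fsuc a))
... | yes asc = trans (cong (λ b → when b p d) (dec-true (_ <? _) asc)) (vanish asc d)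
... | no ¬asc = cong (λ b → when b p d) (dec-false (_ <? _) ¬asc)

Good : ∀ {m} → ℕ → List (Fin m) → Set
Good b w = ∀ g → Shaped b (length w) g (count g (leaves w))

Good-[] : ∀ {m b} → Good {m} b []
Good-[] {m} g with all? (λ i → i ≟ g i)
... | yes id≗g = inj₂ (([] , [] , id≗g) , 0 , 0 , trans (sym (ℓ-cong id≗g)) (ℓ-id {m}) ,
                       λ d → trans (+-identityʳ _) (trans (weight-match 0 id≗g d) (sym (t^0-⊛ (t^ 0) d))))
... | no id≉g  = inj₁ λ d → trans (+-identityʳ _) (weight-mismatch 0 id≉g d)

Good-at-length : ∀ {m b n} {w : List (Fin m)} → n ≡ length w →
  (∀ g → Shaped b n g (count g (leaves w))) → Good b w
Good-at-length refl shaped = shaped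

module Letter {m : ℕ} (a : Fin m) where
  A B : Fin (suc m)
  A = inject₁ a
  B = fsuc a

  σ : Elt m
  σ = gen a

  a⁺ : ℕ
  a⁺ = suc (toℕ a)

  B≢A : B ≢ A
  B≢A = fsuc≢inject₁ a

  σ≡A⇒≡B : ∀ {p} → σ p ≡ A → p ≡ B
  σ≡A⇒≡B {p} σp≡A = trans (sym (gen-involutive a p)) (trans (cong σ σp≡A) (gen-inject₁ a))

  σ≡B⇒≡A : ∀ {p} → σ p ≡ B → p ≡ A
  σ≡B⇒≡A {p} σp≡B = trans (sym (gen-involutive a p)) (trans (cong σ σp≡B) (gen-fsuc a))

  A<a⁺ : toℕ A < a⁺
  A<a⁺ = subst (_< a⁺) (sym (toℕ-inject₁ a)) (n<1+n _)

  B≮A : ¬ toℕ B < toℕ A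
  B≮A B<A = ℕ.<-asym B<A (subst (_< toℕ B) (sym (toℕ-inject₁ a)) (n<1+n _))

  Parabolic⇒fixes-A : ∀ {h : Elt m} → Parabolic a⁺ h → h A ≡ A
  Parabolic⇒fixes-A (fix , _) = proj₁ (fix A) A<a⁺

  moves-A⇒¬Parabolic : ∀ {h : Elt m} → h A ≢ A → ¬ Parabolic a⁺ h
  moves-A⇒¬Parabolic hA≢A par = hA≢A (Parabolic⇒fixes-A par)

  B↦A⇒¬Parabolic : ∀ {h : Elt m} → h B ≡ A → ¬ Parabolic a⁺ h
  B↦A⇒¬Parabolic hB≡A (fix , _) = ℕ.<⇒≱ A<a⁺ (subst (λ p → a⁺ ≤ toℕ p) hB≡A (proj₂ (fix B) ≤-refl))

  Ascent-σ∘ : ∀ {h : Elt m} → FixesBelow a⁺ h → h B ≢ B → Ascent (σ ∘ h) a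
  Ascent-σ∘ {h} fix hB≢B = subst₂ _<_ (sym σhA) (sym σhB) (≤∧≢⇒< a⁺≤hB (hB≢B ∘ toℕ-injective ∘ sym))
    where
    a⁺≤hB : a⁺ ≤ toℕ (h B)
    a⁺≤hB = proj₂ (fix B) ≤-refl
    σhA : toℕ (σ (h A)) ≡ a⁺
    σhA = cong toℕ (trans (cong σ (proj₁ (fix A) A<a⁺)) (gen-inject₁ a))
    σhB : toℕ (σ (h B)) ≡ toℕ (h B)
    σhB = cong toℕ (gen-fixes a (h B) (λ e → ℕ.<⇒≱ (n<1+n _) (subst (a⁺ ≤_) e a⁺≤hB)) (hB≢B ∘ toℕ-injective))

  σ-conj-fixes : ∀ {x : Elt m} → Parabolic a⁺ x → x B ≡ B → ∀ i → σ (x (σ i)) ≡ x i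
  σ-conj-fixes {x} par@(_ , inj) xB≡B i = by-cases (i ≟ A) (i ≟ B)
    where
    xA≡A = Parabolic⇒fixes-A par

    σ-away : ∀ k → k ≢ A → k ≢ B → σ k ≡ k
    σ-away k k≢A k≢B = gen-fixes a k (λ e → k≢A (toℕ-injective (trans e (sym (toℕ-inject₁ a))))) (k≢B ∘ toℕ-injective)

    by-cases : Dec (i ≡ A) → Dec (i ≡ B) → σ (x (σ i)) ≡ x i
    by-cases (yes refl) _ = trans (cong σ (trans (cong x (gen-inject₁ a)) xB≡B)) (trans (gen-fsuc a) (sym xA≡A))
    by-cases (no _) (yes refl) = trans (cong σ (trans (cong x (gen-fsuc a)) xA≡A)) (trans (gen-inject₁ a) (sym xB≡B))
    by-cases (no i≢A) (no i≢B) = trans (cong (σ ∘ x) (σ-away i i≢A i≢B))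
      (σ-away (x i) (λ e → i≢A (inj (trans e (sym xA≡A)))) (λ e → i≢B (inj (trans e (sym xB≡B)))))

  IsProduct-∘σ : ∀ {b} {h : Elt m} → b ≤ toℕ a → IsProduct a⁺ h →
    IsProduct b (h ∘ σ) × ℓ (h ∘ σ) ≡ suc (ℓ h)
  IsProduct-∘σ b≤a prod = IsProduct-·s b≤a (IsProduct-weaken (≤-trans b≤a (n≤1+n _)) prod)
    (FixesBelow⇒Ascent a (proj₁ (IsProduct⇒Parabolic prod)))

  IsProduct-σ∘∘σ : ∀ {b} {h : Elt m} → b ≤ toℕ a → IsProduct a⁺ h → h B ≢ B →
    IsProduct b (σ ∘ h ∘ σ) × ℓ (σ ∘ h ∘ σ) ≡ 2 + ℓ h
  IsProduct-σ∘∘σ b≤a prod hB≢B with IsProduct-gen∘ a b≤a prod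
  ... | prod′ , ℓσh = proj₁ step , trans (proj₂ step) (cong suc ℓσh)
    where
    step = IsProduct-·s b≤a prod′ (Ascent-σ∘ (proj₁ (IsProduct⇒Parabolic prod)) hB≢B)

  module Steps {b} (b≤a : b ≤ toℕ a) (w : List (Fin m)) (aw : LettersFrom a⁺ w) (IH : Good a⁺ w) where
    W = leaves w

    cnt : Elt m → Poly
    cnt h = count h W

    b≤a⁺ : b ≤ a⁺
    b≤a⁺ = ≤-trans b≤a (n≤1+n _)

    vanish : ∀ {h} → ¬ Parabolic a⁺ h → cnt h ≗ 0ₚ
    vanish ¬par = count-vanishes W (leaves-Parabolic w aw) (λ x par x≗h → ¬par (Parabolic-resp-≗ x≗h par))

    vanish-unless-ascent : ∀ {h} → ¬ Ascent h a → cnt h ≗ 0ₚ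
    vanish-unless-ascent ¬asc = vanish (¬asc ∘ FixesBelow⇒Ascent a ∘ proj₁)

    cnt-moves-A : ∀ h → h A ≢ A → cnt h ≗ 0ₚ
    cnt-moves-A h hA≢A = vanish (moves-A⇒¬Parabolic hA≢A)

    cnt-σ∘ : ∀ g → g A ≢ B → cnt (σ ∘ g) ≗ 0ₚ
    cnt-σ∘ g gA≢B = cnt-moves-A (σ ∘ g) (gA≢B ∘ σ≡A⇒≡B)

    cnt-σ∘-A : ∀ g → g A ≡ A → cnt (σ ∘ g) ≗ 0ₚ
    cnt-σ∘-A g gA≡A = cnt-σ∘ g (λ gA≡B → B≢A (trans (sym gA≡B) gA≡A))

    cnt-∘σ : ∀ g → g B ≢ A → cnt (g ∘ σ) ≗ 0ₚ
    cnt-∘σ g gB≢A = cnt-moves-A (g ∘ σ) (gB≢A ∘ trans (cong g (sym (gen-inject₁ a))))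

    cnt-∘σ-A : ∀ g → g A ≡ A → cnt (g ∘ σ) ≗ 0ₚ
    cnt-∘σ-A g gA≡A = vanish (B↦A⇒¬Parabolic (trans (cong g (gen-fsuc a)) gA≡A))

    cnt-σ∘∘σ : ∀ g → g B ≢ B → cnt (σ ∘ g ∘ σ) ≗ 0ₚ
    cnt-σ∘∘σ g gB≢B = cnt-moves-A (σ ∘ g ∘ σ) (gB≢B ∘ σ≡A⇒≡B ∘ trans (cong (σ ∘ g) (sym (gen-inject₁ a))))

    cnt-σ∘∘σ-B : ∀ g → g A ≡ B → cnt (σ ∘ g ∘ σ) ≗ 0ₚ
    cnt-σ∘∘σ-B g gA≡B = vanish (B↦A⇒¬Parabolic (trans (cong (σ ∘ g) (gen-fsuc a)) (trans (cong σ gA≡B) (gen-fsuc a))))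

    shaped-cons : ∀ g → Shaped b (1 + length w) g (count g (leaves (a ∷ w)))
    shaped-cons g with g A ≟ A
    ... | yes gA≡A = Shaped-≗ (≗-trans (count-leaves-cons a g w aw) (⊕-vanishesˡ (cnt-σ∘-A g gA≡A)))
                               (Shaped-weaken b≤a⁺ (Shaped-shift (IH g)))
    ... | no gA≢A  = Shaped-≗ (≗-trans (count-leaves-cons a g w aw) (⊕-vanishesʳ (shift-vanishes (cnt-moves-A g gA≢A))))
                               (Shaped-transport (gen-involutive a ∘ g) (IsProduct-gen∘ a b≤a) (IH (σ ∘ g)))

    shaped-snoc : ∀ g → Shaped b (1 + length w) g (count g (leaves (w ++ [ a ])))
    shaped-snoc g with g A ≟ A
    ... | yes gA≡A = Shaped-≗ (≗-trans (count-leaves-snoc a g w)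
                                (≗-trans (⊕-vanishesˡ (cnt-∘σ-A g gA≡A))
                                         (when-ascent-redundant {g = g} (shift-vanishes ∘ vanish-unless-ascent))))
                               (Shaped-weaken b≤a⁺ (Shaped-shift (IH g)))
    ... | no gA≢A  = Shaped-≗ (≗-trans (count-leaves-snoc a g w)
                                (⊕-vanishesʳ (when-vanishes (ascentᵇ g a) (shift-vanishes (cnt-moves-A g gA≢A)))))
                               (Shaped-transport (cong g ∘ gen-involutive a) (IsProduct-∘σ b≤a) (IH (g ∘ σ)))

    count-leaves-both : ∀ g → count g (leaves (a ∷ w ++ [ a ])) ≗
      (cnt (σ ∘ g ∘ σ) ⊕ shift (cnt (g ∘ σ))) ⊕ when (ascentᵇ g a) (shift (cnt (σ ∘ g) ⊕ shift (cnt g)))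
    count-leaves-both g = ≗-trans (count-leaves-snoc a g (a ∷ w))
      (⊕-cong (count-leaves-cons a (g ∘ σ) w aw) (when-cong (ascentᵇ g a) (shift-cong (count-leaves-cons a g w aw))))

    cnt-conj : ∀ g → g A ≡ A → g B ≡ B → cnt (σ ∘ g ∘ σ) ≗ cnt g
    cnt-conj g gA≡A gB≡B = count-agree W (leaves-Parabolic w aw) to from
      where
      to : ∀ x → Parabolic a⁺ x → x ≗ σ ∘ g ∘ σ → x ≗ g
      to x par x≗ i = trans (sym (σ-conj-fixes par xB≡B i))
                            (trans (cong σ (x≗ (σ i))) (trans (gen-involutive a _) (cong g (gen-involutive a i))))
        where
        xB≡B : x B ≡ B
        xB≡B = trans (x≗ B) (trans (cong (σ ∘ g) (gen-fsuc a)) (trans (cong σ gA≡A) (gen-inject₁ a)))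
      from : ∀ x → Parabolic a⁺ x → x ≗ g → x ≗ σ ∘ g ∘ σ
      from x par x≗g i = trans (sym (σ-conj-fixes par (trans (x≗g B) gB≡B) i)) (cong σ (x≗g (σ i)))

    ascent-part-fixing-A : ∀ g → g A ≡ A →
      when (ascentᵇ g a) (shift (cnt (σ ∘ g) ⊕ shift (cnt g))) ≗ shift (shift (cnt g))
    ascent-part-fixing-A g gA≡A = ≗-trans
      (when-ascent-redundant {g = g} λ ¬asc →
         shift-vanishes (⊕-cong (cnt-σ∘-A g gA≡A) (shift-vanishes (vanish-unless-ascent ¬asc))))
      (shift-cong (⊕-vanishesˡ (cnt-σ∘-A g gA≡A)))

    -- Only elements fixing A can match a leaf of w, so where g sends A and B decides which terms survive.
    shaped-both : ∀ g → Shaped b (2 + length w) g (count g (leaves (a ∷ w ++ [ a ])))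
    shaped-both g with g A ≟ A | g B ≟ B | g B ≟ A | g A ≟ B
    ... | yes gA≡A | yes gB≡B | _ | _ = Shaped-≗ count≗ (Shaped-weaken b≤a⁺ (Shaped-[t²+1] (IH g)))
      where
      count≗ : count g (leaves (a ∷ w ++ [ a ])) ≗ cnt g ⊕ shift (shift (cnt g))
      count≗ = begin
        _ ≈⟨ count-leaves-both g ⟩
        (cnt (σ ∘ g ∘ σ) ⊕ shift (cnt (g ∘ σ))) ⊕ when (ascentᵇ g a) (shift (cnt (σ ∘ g) ⊕ shift (cnt g)))
          ≈⟨ ⊕-cong (⊕-vanishesʳ (shift-vanishes (cnt-∘σ-A g gA≡A))) (ascent-part-fixing-A g gA≡A) ⟩
        cnt (σ ∘ g ∘ σ) ⊕ shift (shift (cnt g))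
          ≈⟨ ⊕-cong (cnt-conj g gA≡A gB≡B) (λ _ → refl) ⟩
        cnt g ⊕ shift (shift (cnt g)) ∎
        where open ≗-Reasoning
    ... | yes gA≡A | no gB≢B | _ | _ = Shaped-≗ count≗ (Shaped-weaken b≤a⁺ (Shaped-shift (Shaped-shift (IH g))))
      where
      count≗ : count g (leaves (a ∷ w ++ [ a ])) ≗ shift (shift (cnt g))
      count≗ = begin
        _ ≈⟨ count-leaves-both g ⟩
        (cnt (σ ∘ g ∘ σ) ⊕ shift (cnt (g ∘ σ))) ⊕ when (ascentᵇ g a) (shift (cnt (σ ∘ g) ⊕ shift (cnt g)))
          ≈⟨ ⊕-vanishesˡ (⊕-cong (cnt-σ∘∘σ g gB≢B) (shift-vanishes (cnt-∘σ-A g gA≡A))) ⟩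
        when (ascentᵇ g a) (shift (cnt (σ ∘ g) ⊕ shift (cnt g)))
          ≈⟨ ascent-part-fixing-A g gA≡A ⟩
        shift (shift (cnt g)) ∎
        where open ≗-Reasoning
    ... | no gA≢A | _ | yes gB≡A | _ =
      Shaped-≗ count≗ (Shaped-shift (Shaped-transport (cong g ∘ gen-involutive a) (IsProduct-∘σ b≤a) (IH (g ∘ σ))))
      where
      σg-dead : Ascent g a → cnt (σ ∘ g) ≗ 0ₚ
      σg-dead asc = cnt-σ∘ g λ gA≡B → B≮A (subst₂ _<_ (cong toℕ gA≡B) (cong toℕ gB≡A) asc)
      count≗ : count g (leaves (a ∷ w ++ [ a ])) ≗ shift (cnt (g ∘ σ))
      count≗ = begin
        _ ≈⟨ count-leaves-both g ⟩
        (cnt (σ ∘ g ∘ σ) ⊕ shift (cnt (g ∘ σ))) ⊕ when (ascentᵇ g a) (shift (cnt (σ ∘ g) ⊕ shift (cnt g)))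
          ≈⟨ ⊕-vanishesʳ (when-ascent-vanishes {g = g} λ asc →
                           shift-vanishes (⊕-cong (σg-dead asc) (shift-vanishes (cnt-moves-A g gA≢A)))) ⟩
        cnt (σ ∘ g ∘ σ) ⊕ shift (cnt (g ∘ σ))
          ≈⟨ ⊕-vanishesˡ (cnt-σ∘∘σ g (λ gB≡B → B≢A (trans (sym gB≡B) gB≡A))) ⟩
        shift (cnt (g ∘ σ)) ∎
        where open ≗-Reasoning
    ... | no gA≢A | _ | no gB≢A | yes gA≡B =
      Shaped-≗ count≗ (Shaped-shift (Shaped-transport (gen-involutive a ∘ g) (IsProduct-gen∘ a b≤a) (IH (σ ∘ g))))
      where
      ascent-unless-σg-dead : Parabolic a⁺ (σ ∘ g) → Ascent g a
      ascent-unless-σg-dead (fix , _) = subst₂ _<_ (cong toℕ (gen-involutive a (g A))) (cong toℕ (gen-involutive a (g B)))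
        (Ascent-σ∘ fix (gB≢A ∘ σ≡B⇒≡A))
      count≗ : count g (leaves (a ∷ w ++ [ a ])) ≗ shift (cnt (σ ∘ g))
      count≗ = begin
        _ ≈⟨ count-leaves-both g ⟩
        (cnt (σ ∘ g ∘ σ) ⊕ shift (cnt (g ∘ σ))) ⊕ when (ascentᵇ g a) (shift (cnt (σ ∘ g) ⊕ shift (cnt g)))
          ≈⟨ ⊕-vanishesˡ (⊕-cong (cnt-σ∘∘σ-B g gA≡B) (shift-vanishes (cnt-∘σ g gB≢A))) ⟩
        when (ascentᵇ g a) (shift (cnt (σ ∘ g) ⊕ shift (cnt g)))
          ≈⟨ when-cong (ascentᵇ g a) (shift-cong (⊕-vanishesʳ (shift-vanishes (cnt-moves-A g gA≢A)))) ⟩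
        when (ascentᵇ g a) (shift (cnt (σ ∘ g)))
          ≈⟨ when-ascent-redundant {g = g} (λ ¬asc → shift-vanishes (vanish (¬asc ∘ ascent-unless-σg-dead))) ⟩
        shift (cnt (σ ∘ g)) ∎
        where open ≗-Reasoning
    ... | no gA≢A | _ | no gB≢A | no gA≢B =
      Shaped-≗ count≗ (Shaped-transport (λ i → trans (gen-involutive a _) (cong g (gen-involutive a i)))
                                        (λ prod → IsProduct-σ∘∘σ b≤a prod
                                                    (gA≢A ∘ trans (cong g (sym (gen-fsuc a))) ∘ σ≡B⇒≡A))
                                        (IH (σ ∘ g ∘ σ)))
      where
      count≗ : count g (leaves (a ∷ w ++ [ a ])) ≗ cnt (σ ∘ g ∘ σ)
      count≗ = begin
        _ ≈⟨ count-leaves-both g ⟩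
        (cnt (σ ∘ g ∘ σ) ⊕ shift (cnt (g ∘ σ))) ⊕ when (ascentᵇ g a) (shift (cnt (σ ∘ g) ⊕ shift (cnt g)))
          ≈⟨ ⊕-vanishesʳ (when-vanishes (ascentᵇ g a)
                (shift-vanishes (⊕-cong (cnt-σ∘ g gA≢B) (shift-vanishes (cnt-moves-A g gA≢A))))) ⟩
        cnt (σ ∘ g ∘ σ) ⊕ shift (cnt (g ∘ σ))
          ≈⟨ ⊕-vanishesʳ (shift-vanishes (cnt-∘σ g gB≢A)) ⟩
        cnt (σ ∘ g ∘ σ) ∎
        where open ≗-Reasoning

data Nested {m : ℕ} : List (Fin m) → Set where
  []   : Nested []
  cons : ∀ {a w} → All (a <ꟳ_) w → Nested w → Nested (a ∷ w)
  snoc : ∀ {a w} → All (a <ꟳ_) w → Nested w → Nested (w ++ [ a ])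
  both : ∀ {a w} → All (a <ꟳ_) w → Nested w → Nested (a ∷ w ++ [ a ])

length-∷ʳ : ∀ {A : Set} (w : List A) {a} → length (w ++ [ a ]) ≡ 1 + length w
length-∷ʳ w = trans (length-++ w) (+-comm (length w) 1)

Nested⇒Good : ∀ {m b} {w : List (Fin m)} → Nested w → LettersFrom b w → Good b w
Nested⇒Good [] _ = Good-[]
Nested⇒Good (cons {a} {w} aw nw) (b≤a ∷ _) = Letter.Steps.shaped-cons a b≤a w aw (Nested⇒Good nw aw)
Nested⇒Good (snoc {a} {w} aw nw) bw with ++⁻ʳ w bw
... | b≤a ∷ [] = Good-at-length {w = w ++ [ a ]} (sym (length-∷ʳ w)) (Letter.Steps.shaped-snoc a b≤a w aw (Nested⇒Good nw aw))
Nested⇒Good (both {a} {w} aw nw) (b≤a ∷ _) =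
  Good-at-length {w = a ∷ w ++ [ a ]} (sym (cong suc (length-∷ʳ w))) (Letter.Steps.shaped-both a b≤a w aw (Nested⇒Good nw aw))

AllPairs-∷ʳ⁻ : ∀ {A : Set} {R : A → A → Set} {x} (xs : List A) →
  AllPairs R (xs ∷ʳ x) → AllPairs R xs × All (λ y → R y x) xs
AllPairs-∷ʳ⁻ []       _           = [] , []
AllPairs-∷ʳ⁻ (y ∷ xs) (ry ∷ rxs) with ++⁻ xs ry | AllPairs-∷ʳ⁻ xs rxs
... | ry-xs , (ryx ∷ []) | rxs′ , rx = (ry-xs ∷ rxs′) , (ryx ∷ rx)

module _ {m : ℕ} where
  -- The smallest letter of p ++ q is the first letter of p or the last letter of q.
  Nested-++ : ∀ {p q : List (Fin m)} → AllPairs _<ꟳ_ p → Reverse q → AllPairs _>ꟳ_ q → Nested (p ++ q)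
  Nested-++-by-order : ∀ {x y : Fin m} {p q} → AllPairs _<ꟳ_ (x ∷ p) → Reverse q → AllPairs _>ꟳ_ (q ∷ʳ y) →
    Tri (x <ꟳ y) (x ≡ y) (y <ꟳ x) → Nested ((x ∷ p) ++ q ∷ʳ y)

  Nested-++ []         []            _  = []
  Nested-++ []         (q ∶ rq ∶ʳ y) gq = let gq′ , q>y = AllPairs-∷ʳ⁻ q gq in snoc q>y (Nested-++ [] rq gq′)
  Nested-++ (x<p ∷ gp) []            _  = cons (++⁺ x<p []) (Nested-++ gp [] [])
  Nested-++ {x ∷ _} gp@(_ ∷ _) (_ ∶ rq ∶ʳ y) gq = Nested-++-by-order gp rq gq (<-cmpꟳ x y)

  Nested-++-by-order {q = q} (x<p ∷ gp) rq gq (tri< x<y _ _) =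
    cons (++⁺ x<p (∷ʳ⁺ (All.map (<-transꟳ x<y) (proj₂ (AllPairs-∷ʳ⁻ q gq))) x<y)) (Nested-++ gp (q ∶ rq ∶ʳ _) gq)
  Nested-++-by-order {x} {y} {p} {q} gp@(x<p ∷ _) rq gq (tri> _ _ y<x) =
    let gq′ , q>y = AllPairs-∷ʳ⁻ q gq in
    subst Nested (++-assoc (x ∷ p) q [ y ]) (snoc (y<x ∷ ++⁺ (All.map (<-transꟳ y<x) x<p) q>y) (Nested-++ gp rq gq′))
  Nested-++-by-order {x} {p = p} {q} (x<p ∷ gp) rq gq (tri≈ _ refl _) =
    let gq′ , q>x = AllPairs-∷ʳ⁻ q gq in
    subst Nested (cong (x ∷_) (++-assoc p q [ x ])) (both (++⁺ x<p q>x) (Nested-++ gp rq gq′))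

  UDWord⇒Nested : ∀ {v : List (Fin m)} → UDWord v → Nested v
  UDWord⇒Nested (pre , t , suf , refl , pre↑ , pre<t , suf↓ , suf<t) =
    Nested-++ (Linked⇒AllPairs <-transꟳ pre↑) (reverseView (t ∷ suf))
              (suf<t ∷ Linked⇒AllPairs (λ i>j j>k → <-transꟳ j>k i>j) suf↓)

sum-of-monomials : ∀ {m} → List (Node m) → Poly
sum-of-monomials = foldr (λ nd acc → t^ (proj₂ nd) ⊕ acc) 0ₚ

R̃≗count : ∀ {m} (u : Permutation′ (suc m)) v → R̃ u v ≗ count (u ⟨$⟩ʳ_) (leaves v)
R̃≗count u v = go (leaves v)
  where
  go : ∀ L → sum-of-monomials (filter (λ nd → all? (λ x → proj₁ nd x ≟ (u ⟨$⟩ʳ x))) L) ≗ count (u ⟨$⟩ʳ_) L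
  go []            d = refl
  go ((x , e) ∷ L) d with does (all? (λ i → x i ≟ (u ⟨$⟩ʳ i)))
  ... | true  = cong (t^ e d +_) (go L d)
  ... | false = go L d

monomials-vanish⇒[] : ∀ {m} (L : List (Node m)) → sum-of-monomials L ≗ 0ₚ → L ≡ []
monomials-vanish⇒[] []            _     = refl
monomials-vanish⇒[] ((x , e) ∷ L) sum≗0 =
  ⊥-elim (ℕ.1+n≢0 (trans (cong (λ b → 𝟙 b + sum-of-monomials L e) (sym (dec-true (e ℕ.≟ e) refl))) (sum≗0 e)))

theorem4p2 : (m : ℕ) (v : List (Fin m)) → UDWord v →
    (u : Permutation′ (suc m)) → 𝕃 v u ≢ [] →
    ∃[ c ] ∃[ k ] ( 2 * k + c + ℓ (u ⟨$⟩ʳ_) ≡ length v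
                  × (∀ d → R̃ u v d ≡ (t^ c ⊛ ((t^ 2 ⊕ t^ 0) ^ₚ k)) d) )
theorem4p2 m v ud u 𝕃≢[] with Nested⇒Good (UDWord⇒Nested ud) (All.universal (λ _ → z≤n) v) (u ⟨$⟩ʳ_)
... | inj₁ count≗0                   = ⊥-elim (𝕃≢[] (monomials-vanish⇒[] (𝕃 v u) (≗-trans (R̃≗count u v) count≗0)))
... | inj₂ (_ , c , k , len , count≗) = c , k , len , ≗-trans (R̃≗count u v) count≗
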